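{- Every pseudocylinder (in particular every cylinder) is fully balanced.
   Context: A basic cube is $[x,x+1]\times[y,y+1]\times[z,z+1]$, $(x,y,z)\in\mathbb{Z}^3$; white if $x+y+z$ even, black if odd. A region is a finite union of basic cubes. $\Delta=\{e_x,e_y,e_z\}$. A basic plane is a plane $x=k$, $y=k$ or $z=k$ with $k\in\mathbb{Z}$; a planar region in it is a finite union of unit squares with integer vertices. A pseudocylinder is $\mathcal{D}+[0,N]w=\{p+sw:p\in\mathcal{D},s\in[0,N]\}$ with $w\in\Delta$, $\mathcal{D}$ a planar region with connected interior in a basic plane with normal $w$ (not necessarily simply connected), and $N$ a positive integer; a cylinder is a pseudocylinder whose base $\mathcal{D}$ is simply connected. A region $\mathcal{R}$ is fully balanced with respect to $u\in\Delta$ if for every square $Q$ of side $2$ with vertices in $\mathbb{Z}^3$ lying in a plane perpendicular to $u$ and with $Q\subset\mathcal{R}$, each of the two sets $\mathcal{R}\cap(Q+[0,\infty)u)$ and $\mathcal{R}\cap(Q+[0,\infty)(-u))$ contains as many black basic cubes as white basic cubes. $\mathcal{R}$ is fully balanced if it is fully balanced with respect to each $u\in\Delta$. -}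

module Defs where

open import Data.Nat as ℕ using (ℕ; suc; _%_)
open import Data.Integer as ℤ using (ℤ; +_; _+_; _-_; ∣_∣; _≤ᵇ_)
import Data.Integer.Properties as ℤP
open import Data.Bool using (Bool; true; false; not; _∧_; _∨_; T)
open import Data.List using (List; []; _∷_; length; filterᵇ; deduplicate; concatMap; map; upTo)
open import Data.List.Membership.Propositional using (_∈_)
open import Data.Product using (_×_; _,_; ∃-syntax)
open import Data.Product.Properties using (≡-dec)
open import Data.Sum using (_⊎_)
open import Relation.Binary.PropositionalEquality using (_≡_)
open import Relation.Nullary.Decidable using (⌊_⌋)

-- A basic cube [x,x+1]×[y,y+1]×[z,z+1] is identified with its corner (x,y,z).
Cell : Set
Cell = ℤ × ℤ × ℤ

-- A region: a finite union of basic cubes, given by a finite list of cubes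
-- (repetitions allowed and irrelevant).
Region : Set
Region = List Cell

isBlack : Cell → Bool
isBlack (x , y , z) = ⌊ (∣ x + y + z ∣ % 2) ℕ.≟ 1 ⌋

isWhite : Cell → Bool
isWhite c = not (isBlack c)

data Dir : Set where
  ex ey ez : Dir

-- Coordinates in a basic plane with normal w: the two remaining coordinates
-- in increasing order ((y,z) for e_x, (x,z) for e_y, (x,y) for e_z).
-- embed w (a , b) t is the cube whose w-coordinate is t and whose other
-- coordinates are (a , b).
embed : Dir → ℤ × ℤ → ℤ → Cell
embed ex (a , b) t = (t , a , b)
embed ey (a , b) t = (a , t , b)
embed ez (a , b) t = (a , b , t)

wcoord : Dir → Cell → ℤ
wcoord ex (x , y , z) = x
wcoord ey (x , y , z) = y
wcoord ez (x , y , z) = z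

pcoord : Dir → Cell → ℤ × ℤ
pcoord ex (x , y , z) = (y , z)
pcoord ey (x , y , z) = (x , z)
pcoord ez (x , y , z) = (x , y)

countᵇ : (Cell → Bool) → Region → ℕ
countᵇ p R = length (deduplicate (≡-dec ℤ._≟_ (≡-dec ℤ._≟_ ℤ._≟_)) (filterᵇ p R))

_≡ᵇ_ : ℤ → ℤ → Bool
m ≡ᵇ n = ⌊ m ℤ.≟ n ⌋

inBlock : ℤ → ℤ → ℤ × ℤ → Bool
inBlock a b (p , q) = ((p ≡ᵇ a) ∨ (p ≡ᵇ (a + + 1))) ∧ ((q ≡ᵇ b) ∨ (q ≡ᵇ (b + + 1)))

-- The basic cubes contained in Q + [0,∞)u, where Q = the 2×2 square with
-- lower corner (a,b) (in-plane coordinates) in the plane {u-coordinate = k}.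
inUpPrism : Dir → ℤ → ℤ → ℤ → Cell → Bool
inUpPrism u a b k c = inBlock a b (pcoord u c) ∧ (k ≤ᵇ wcoord u c)

-- The basic cubes contained in Q + [0,∞)(-u).
inDownPrism : Dir → ℤ → ℤ → ℤ → Cell → Bool
inDownPrism u a b k c = inBlock a b (pcoord u c) ∧ not (k ≤ᵇ wcoord u c)

-- A closed unit square (in-plane lower corner s) of the plane {u = k} is
-- contained in the region iff one of the two basic cubes having it as a face
-- belongs to the region.
UnitSquareIn : Dir → ℤ × ℤ → ℤ → Region → Set
UnitSquareIn u s k R = embed u s k ∈ R ⊎ embed u s (k - + 1) ∈ R

SquareIn : Dir → ℤ → ℤ → ℤ → Region → Set
SquareIn u a b k R =
  UnitSquareIn u (a , b) k R × UnitSquareIn u (a + + 1 , b) k R ×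
  UnitSquareIn u (a , b + + 1) k R × UnitSquareIn u (a + + 1 , b + + 1) k R

FullyBalancedWrt : Dir → Region → Set
FullyBalancedWrt u R = ∀ (a b k : ℤ) → SquareIn u a b k R →
  (countᵇ (λ c → inUpPrism u a b k c ∧ isBlack c) R
     ≡ countᵇ (λ c → inUpPrism u a b k c ∧ isWhite c) R)
  × (countᵇ (λ c → inDownPrism u a b k c ∧ isBlack c) R
     ≡ countᵇ (λ c → inDownPrism u a b k c ∧ isWhite c) R)

FullyBalanced : Region → Set
FullyBalanced R = ∀ (u : Dir) → FullyBalancedWrt u R

-- Planar regions: finite unions of unit squares in a basic plane, each square
-- given by its lower corner in in-plane coordinates.
PlanarRegion : Set
PlanarRegion = List (ℤ × ℤ)

Adj : ℤ × ℤ → ℤ × ℤ → Set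
Adj (a , b) (a' , b') =
  ((a' ≡ a + + 1 ⊎ a ≡ a' + + 1) × b ≡ b') ⊎ (a ≡ a' × (b' ≡ b + + 1 ⊎ b ≡ b' + + 1))

data Chain (D : PlanarRegion) : ℤ × ℤ → ℤ × ℤ → Set where
  here : ∀ {p} → Chain D p p
  step : ∀ {p r q} → Adj p r → r ∈ D → Chain D r q → Chain D p q

ConnectedInterior : PlanarRegion → Set
ConnectedInterior D = ∀ {p q} → p ∈ D → q ∈ D → Chain D p q

-- D + [0,N]w, for D lying in the basic plane {w-coordinate = k}.
pseudocylinder : Dir → ℤ → PlanarRegion → ℕ → Region
pseudocylinder w k D N =
  concatMap (λ s → map (λ t → embed w s (k + + t)) (upTo N)) D

-- Fix a side-2 square Q in a plane perpendicular to u and one half-prism P over Q.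
-- Reflecting one in-plane coordinate across the midline of Q exchanges the two rows of
-- columns over Q and changes that coordinate by ±1, so it is a colour-reversing
-- involution of P. If u is the direction w of the pseudocylinder R, then Q ⊂ R puts
-- all four columns over Q in the base, so either reflection keeps R ∩ P inside R.
-- Otherwise w is an in-plane axis of Q, and Q ⊂ R puts both w-levels met by Q in the
-- height range of R, so the reflection along w keeps R ∩ P inside R. Either way
-- R ∩ P has as many black as white cubes.
module Submission where

open import Defs
open import Data.Bool using (Bool; not; _∧_; _∨_; T; T?)
open import Data.Bool.Properties using (not-involutive; T-∧; T-∨)
open import Data.Integer as ℤ using (ℤ; +_; -[1+_]; _+_; _-_; ∣_∣; _≤ᵇ_)
open import Data.Integer.Tactic.RingSolver using (solve-∀)
open import Data.List using (length; map; filterᵇ; deduplicate; upTo)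
open import Data.List.Properties using (length-map)
open import Data.List.Membership.Propositional using (_∈_; find; lose)
open import Data.List.Membership.Propositional.Properties
  using (∈-map⁺; ∈-map⁻; ∈-filter⁺; ∈-filter⁻; ∈-deduplicate⁺; ∈-deduplicate⁻; ∈-concatMap⁺; ∈-concatMap⁻; ∈-upTo⁺; ∈-upTo⁻)
open import Data.List.Membership.Propositional.Properties.WithK using (unique∧set⇒bag)
open import Data.List.Relation.Binary.BagAndSetEquality using (_∼[_]_; set; ∼bag⇒↭)
open import Data.List.Relation.Binary.Permutation.Propositional.Properties using (↭-length)
open import Data.List.Relation.Unary.Unique.Propositional.Properties using (map⁺)
open import Data.List.Relation.Unary.Unique.DecPropositional.Properties using (deduplicate-!)
open import Data.Nat as ℕ using (ℕ; zero; suc; _%_; _<_; NonZero)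
open import Data.Nat.DivMod using ([m+n]%n≡m%n)
import Data.Nat.Properties as ℕP
open import Data.Product using (_×_; _,_; proj₁; proj₂; ∃-syntax)
open import Data.Product.Properties using (≡-dec)
open import Data.Sum using (_⊎_; inj₁; inj₂)
import Data.Sum as Sum
open import Function using (_∘_; Equivalence; mk⇔)
open import Relation.Binary.Definitions using (DecidableEquality)
open import Relation.Binary.PropositionalEquality
open import Relation.Nullary.Decidable using (⌊_⌋; toWitness; fromWitness)

open Equivalence using (to; from)

module _ {a} {A : Set a} (_≟_ : DecidableEquality A) where

  private
    ∈-dedup-filter⁻ : ∀ {p xs x} → x ∈ deduplicate _≟_ (filterᵇ p xs) → x ∈ xs × T (p x)
    ∈-dedup-filter⁻ {p} {xs} = ∈-filter⁻ (λ y → T? (p y)) ∘ ∈-deduplicate⁻ _≟_ (filterᵇ p xs)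

    ∈-dedup-filter⁺ : ∀ {p xs x} → x ∈ xs → T (p x) → x ∈ deduplicate _≟_ (filterᵇ p xs)
    ∈-dedup-filter⁺ {p} x∈ px = ∈-deduplicate⁺ _≟_ (∈-filter⁺ (λ y → T? (p y)) x∈ px)

  length-deduplicate-filterᵇ-≡ : ∀ (σ : A → A) (p q : A → Bool) xs → (∀ x → σ (σ x) ≡ x) →
    (∀ {x} → x ∈ xs → T (p x) → σ x ∈ xs × T (q (σ x))) →
    (∀ {x} → x ∈ xs → T (q x) → σ x ∈ xs × T (p (σ x))) →
    length (deduplicate _≟_ (filterᵇ p xs)) ≡ length (deduplicate _≟_ (filterᵇ q xs))
  length-deduplicate-filterᵇ-≡ σ p q xs σ-involutive p⇒q q⇒p = begin
    length Sp          ≡⟨ length-map σ Sp ⟨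
    length (map σ Sp)  ≡⟨ ↭-length (∼bag⇒↭ (unique∧set⇒bag
                            (map⁺ σ-injective (deduplicate-! _≟_ _)) (deduplicate-! _≟_ _) σSp∼Sq)) ⟩
    length Sq          ∎
    where
    open ≡-Reasoning
    Sp = deduplicate _≟_ (filterᵇ p xs)
    Sq = deduplicate _≟_ (filterᵇ q xs)

    σ-injective : ∀ {x y} → σ x ≡ σ y → x ≡ y
    σ-injective {x} {y} e = trans (sym (σ-involutive x)) (trans (cong σ e) (σ-involutive y))

    σSp∼Sq : map σ Sp ∼[ set ] Sq
    σSp∼Sq {y} = mk⇔ image⊆ ⊆image
      where
      image⊆ : y ∈ map σ Sp → y ∈ Sq
      image⊆ y∈ with ∈-map⁻ σ y∈
      ... | x , x∈ , refl = let x∈xs , px = ∈-dedup-filter⁻ x∈ ; σx∈xs , qσx = p⇒q x∈xs px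
                            in ∈-dedup-filter⁺ σx∈xs qσx
      ⊆image : y ∈ Sq → y ∈ map σ Sp
      ⊆image y∈ = let y∈xs , qy = ∈-dedup-filter⁻ y∈ ; σy∈xs , pσy = q⇒p y∈xs qy
                  in subst (_∈ map σ Sp) (σ-involutive y) (∈-map⁺ σ (∈-dedup-filter⁺ σy∈xs pσy))

countᵇ-black≡white : ∀ (R : Region) (P : Cell → Bool) (σ : Cell → Cell) → (∀ c → σ (σ c) ≡ c) →
  (∀ {c} → c ∈ R → T (P c) → σ c ∈ R × T (P (σ c)) × isBlack (σ c) ≡ not (isBlack c)) →
  countᵇ (λ c → P c ∧ isBlack c) R ≡ countᵇ (λ c → P c ∧ isWhite c) R
countᵇ-black≡white R P σ σ-involutive σ-reverses =
  length-deduplicate-filterᵇ-≡ (≡-dec ℤ._≟_ (≡-dec ℤ._≟_ ℤ._≟_)) σ _ _ R σ-involutive black⇒white white⇒black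
  where
  black⇒white : ∀ {c} → c ∈ R → T (P c ∧ isBlack c) → σ c ∈ R × T (P (σ c) ∧ isWhite (σ c))
  black⇒white {c} c∈R Pc∧black with to T-∧ Pc∧black
  ... | Pc , black with σ-reverses c∈R Pc
  ... | σc∈R , Pσc , colour = σc∈R , from T-∧ (Pσc , subst T eq black)
    where
    eq : isBlack c ≡ not (isBlack (σ c))
    eq = trans (sym (not-involutive _)) (cong not (sym colour))

  white⇒black : ∀ {c} → c ∈ R → T (P c ∧ isWhite c) → σ c ∈ R × T (P (σ c) ∧ isBlack (σ c))
  white⇒black c∈R Pc∧white with to T-∧ Pc∧white
  ... | Pc , white with σ-reverses c∈R Pc
  ... | σc∈R , Pσc , colour = σc∈R , from T-∧ (Pσc , subst T (sym colour) white)

odd : ℕ → Bool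
odd m = ⌊ m % 2 ℕ.≟ 1 ⌋

odd-suc-suc : ∀ m → odd (suc (suc m)) ≡ odd m
odd-suc-suc m = cong (λ r → ⌊ r ℕ.≟ 1 ⌋) (trans (cong (_% 2) (ℕP.+-comm 2 m)) ([m+n]%n≡m%n m 2))

odd-suc : ∀ m → odd (suc m) ≡ not (odd m)
odd-suc zero = refl
odd-suc (suc zero) = refl
odd-suc (suc (suc m)) = begin
  odd (suc (suc (suc m)))  ≡⟨ odd-suc-suc (suc m) ⟩
  odd (suc m)              ≡⟨ odd-suc m ⟩
  not (odd m)              ≡⟨ cong not (odd-suc-suc m) ⟨
  not (odd (suc (suc m)))  ∎
  where open ≡-Reasoning

odd-∣+1∣ : ∀ n → odd ∣ n + + 1 ∣ ≡ not (odd ∣ n ∣)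
odd-∣+1∣ (+ m) = trans (cong odd (ℕP.+-comm m 1)) (odd-suc m)
odd-∣+1∣ -[1+ zero ] = refl
odd-∣+1∣ -[1+ suc m ] = sym (trans (cong not (odd-suc (suc m))) (not-involutive _))

isBlack-embed-suc : ∀ v s t → isBlack (embed v s (t + + 1)) ≡ not (isBlack (embed v s t))
isBlack-embed-suc ex (p , q) t = trans (cong (odd ∘ ∣_∣) (regroup t p q)) (odd-∣+1∣ (t + p + q))
  where regroup : ∀ t p q → t + + 1 + p + q ≡ t + p + q + + 1
        regroup = solve-∀
isBlack-embed-suc ey (p , q) t = trans (cong (odd ∘ ∣_∣) (regroup t p q)) (odd-∣+1∣ (p + t + q))
  where regroup : ∀ t p q → p + (t + + 1) + q ≡ p + t + q + + 1
        regroup = solve-∀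
isBlack-embed-suc ez (p , q) t = trans (cong (odd ∘ ∣_∣) (regroup t p q)) (odd-∣+1∣ (p + q + t))
  where regroup : ∀ t p q → p + q + (t + + 1) ≡ p + q + t + + 1
        regroup = solve-∀

isBlack-embed-adjacent : ∀ v s {t t'} → t' ≡ t + + 1 ⊎ t ≡ t' + + 1 →
  isBlack (embed v s t') ≡ not (isBlack (embed v s t))
isBlack-embed-adjacent v s {t} (inj₁ refl) = isBlack-embed-suc v s t
isBlack-embed-adjacent v s {t' = t'} (inj₂ refl) =
  sym (trans (cong not (isBlack-embed-suc v s t')) (not-involutive _))

-- reflect α is the reflection of ℤ in α + 1/2; it exchanges α and α + 1.
reflect : ℤ → ℤ → ℤ
reflect α x = α + α + + 1 - x

reflect-involutive : ∀ α x → reflect α (reflect α x) ≡ x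
reflect-involutive = expanded
  where expanded : ∀ α x → α + α + + 1 - (α + α + + 1 - x) ≡ x
        expanded = solve-∀

reflect-lower : ∀ α → reflect α α ≡ α + + 1
reflect-lower = expanded
  where expanded : ∀ α → α + α + + 1 - α ≡ α + + 1
        expanded = solve-∀

reflect-upper : ∀ α → reflect α (α + + 1) ≡ α
reflect-upper = expanded
  where expanded : ∀ α → α + α + + 1 - (α + + 1) ≡ α
        expanded = solve-∀

InPair : ℤ → ℤ → Set
InPair α x = x ≡ α ⊎ x ≡ α + + 1

reflect-InPair : ∀ {α x} → InPair α x → InPair α (reflect α x)
reflect-InPair {α} (inj₁ refl) = inj₂ (reflect-lower α)
reflect-InPair {α} (inj₂ refl) = inj₁ (reflect-upper α)

reflect-InPair-adjacent : ∀ {α x} → InPair α x → reflect α x ≡ x + + 1 ⊎ x ≡ reflect α x + + 1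
reflect-InPair-adjacent {α} (inj₁ refl) = inj₁ (reflect-lower α)
reflect-InPair-adjacent {α} (inj₂ refl) = inj₂ (cong (_+ + 1) (sym (reflect-upper α)))

InPair⁻ : ∀ {α x} → T ((x ≡ᵇ α) ∨ (x ≡ᵇ (α + + 1))) → InPair α x
InPair⁻ {α} {x} t with to (T-∨ {x ≡ᵇ α}) t
... | inj₁ x≡α = inj₁ (toWitness x≡α)
... | inj₂ x≡α+1 = inj₂ (toWitness x≡α+1)

InPair⁺ : ∀ {α x} → InPair α x → T ((x ≡ᵇ α) ∨ (x ≡ᵇ (α + + 1)))
InPair⁺ {α} {x} x∈ = from (T-∨ {x ≡ᵇ α}) (Sum.map fromWitness fromWitness x∈)

inBlock⁻ : ∀ {a b p q} → T (inBlock a b (p , q)) → InPair a p × InPair b q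
inBlock⁻ {a} {b} {p} {q} t = let tp , tq = to (T-∧ {(p ≡ᵇ a) ∨ (p ≡ᵇ (a + + 1))}) t in InPair⁻ tp , InPair⁻ tq

inBlock⁺ : ∀ {a b p q} → InPair a p → InPair b q → T (inBlock a b (p , q))
inBlock⁺ {a} {b} {p} p∈ q∈ = from (T-∧ {(p ≡ᵇ a) ∨ (p ≡ᵇ (a + + 1))}) (InPair⁺ p∈ , InPair⁺ q∈)

axis₁ axis₂ : Dir → Dir
axis₁ ex = ey
axis₁ ey = ex
axis₁ ez = ex
axis₂ ex = ez
axis₂ ey = ez
axis₂ ez = ey

pcoord-axes : ∀ u c → pcoord u c ≡ (wcoord (axis₁ u) c , wcoord (axis₂ u) c)
pcoord-axes ex c = refl
pcoord-axes ey c = refl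
pcoord-axes ez c = refl

pcoord-embed : ∀ v s t → pcoord v (embed v s t) ≡ s
pcoord-embed ex s t = refl
pcoord-embed ey s t = refl
pcoord-embed ez s t = refl

wcoord-embed : ∀ v s t → wcoord v (embed v s t) ≡ t
wcoord-embed ex s t = refl
wcoord-embed ey s t = refl
wcoord-embed ez s t = refl

embed-coords : ∀ v c → embed v (pcoord v c) (wcoord v c) ≡ c
embed-coords ex c = refl
embed-coords ey c = refl
embed-coords ez c = refl

mirror : Dir → ℤ → Cell → Cell
mirror v α c = embed v (pcoord v c) (reflect α (wcoord v c))

mirror-involutive : ∀ v α c → mirror v α (mirror v α c) ≡ c
mirror-involutive ex α (x , y , z) = cong (λ x' → x' , y , z) (reflect-involutive α x)
mirror-involutive ey α (x , y , z) = cong (λ y' → x , y' , z) (reflect-involutive α y)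
mirror-involutive ez α (x , y , z) = cong (λ z' → x , y , z') (reflect-involutive α z)

isBlack-mirror : ∀ v {α} c → InPair α (wcoord v c) → isBlack (mirror v α c) ≡ not (isBlack c)
isBlack-mirror ex c α∈ = isBlack-embed-adjacent ex (pcoord ex c) (reflect-InPair-adjacent α∈)
isBlack-mirror ey c α∈ = isBlack-embed-adjacent ey (pcoord ey c) (reflect-InPair-adjacent α∈)
isBlack-mirror ez c α∈ = isBlack-embed-adjacent ez (pcoord ez c) (reflect-InPair-adjacent α∈)

wcoord-mirror-axis₁ : ∀ u α c → wcoord u (mirror (axis₁ u) α c) ≡ wcoord u c
wcoord-mirror-axis₁ ex α c = refl
wcoord-mirror-axis₁ ey α c = refl
wcoord-mirror-axis₁ ez α c = refl

-- inUpPrism u a b k and inDownPrism u a b k are inPrism u a b (k ≤ᵇ_) and inPrism u a b (not ∘ (k ≤ᵇ_)).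
inPrism : Dir → ℤ → ℤ → (ℤ → Bool) → Cell → Bool
inPrism u a b g c = inBlock a b (pcoord u c) ∧ g (wcoord u c)

inPrism⇒inBlock : ∀ {u a b} g c → T (inPrism u a b g c) → T (inBlock a b (pcoord u c))
inPrism⇒inBlock {u} {a} {b} g c = proj₁ ∘ to (T-∧ {inBlock a b (pcoord u c)})

-- The in-plane axes of the square [a , a + 2] × [b , b + 2] perpendicular to u,
-- each with the lower end of the square's extent along it.
data InPlaneAxis (u : Dir) (a b : ℤ) : Dir → ℤ → Set where
  first  : InPlaneAxis u a b (axis₁ u) a
  second : InPlaneAxis u a b (axis₂ u) b

normal-or-inPlane : ∀ u w a b → u ≡ w ⊎ ∃[ α ] InPlaneAxis u a b w α
normal-or-inPlane ex ex a b = inj₁ refl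
normal-or-inPlane ex ey a b = inj₂ (a , first)
normal-or-inPlane ex ez a b = inj₂ (b , second)
normal-or-inPlane ey ex a b = inj₂ (a , first)
normal-or-inPlane ey ey a b = inj₁ refl
normal-or-inPlane ey ez a b = inj₂ (b , second)
normal-or-inPlane ez ex a b = inj₂ (a , first)
normal-or-inPlane ez ey a b = inj₂ (b , second)
normal-or-inPlane ez ez a b = inj₁ refl

inBlock-reflect₁ : ∀ {a b} p q x → T (inBlock a b (p , q) ∧ x) →
  InPair a p × T (inBlock a b (reflect a p , q) ∧ x)
inBlock-reflect₁ {a} {b} p q x t =
  let blk , tx = to (T-∧ {inBlock a b (p , q)}) t ; p∈ , q∈ = inBlock⁻ {a} {b} {p} {q} blk
  in p∈ , from (T-∧ {inBlock a b (reflect a p , q)}) (inBlock⁺ (reflect-InPair p∈) q∈ , tx)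

inBlock-reflect₂ : ∀ {a b} p q x → T (inBlock a b (p , q) ∧ x) →
  InPair b q × T (inBlock a b (p , reflect b q) ∧ x)
inBlock-reflect₂ {a} {b} p q x t =
  let blk , tx = to (T-∧ {inBlock a b (p , q)}) t ; p∈ , q∈ = inBlock⁻ {a} {b} {p} {q} blk
  in q∈ , from (T-∧ {inBlock a b (p , reflect b q)}) (inBlock⁺ p∈ (reflect-InPair q∈) , tx)

inPrism-mirror : ∀ {u a b v α} g c → InPlaneAxis u a b v α → T (inPrism u a b g c) →
  InPair α (wcoord v c) × T (inPrism u a b g (mirror v α c))
inPrism-mirror {ex} g (x , y , z) first  = inBlock-reflect₁ y z (g x)
inPrism-mirror {ey} g (x , y , z) first  = inBlock-reflect₁ x z (g y)
inPrism-mirror {ez} g (x , y , z) first  = inBlock-reflect₁ x y (g z)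
inPrism-mirror {ex} g (x , y , z) second = inBlock-reflect₂ y z (g x)
inPrism-mirror {ey} g (x , y , z) second = inBlock-reflect₂ x z (g y)
inPrism-mirror {ez} g (x , y , z) second = inBlock-reflect₂ x y (g z)

inPrism-balanced-by-mirror : ∀ R {u a b v α} g → InPlaneAxis u a b v α →
  (∀ {c} → c ∈ R → T (inPrism u a b g c) → mirror v α c ∈ R) →
  countᵇ (λ c → inPrism u a b g c ∧ isBlack c) R ≡ countᵇ (λ c → inPrism u a b g c ∧ isWhite c) R
inPrism-balanced-by-mirror R {u} {a} {b} {v} {α} g axis closed =
  countᵇ-black≡white R (inPrism u a b g) (mirror v α) (mirror-involutive v α) reverses
  where
  reverses : ∀ {c} → c ∈ R → T (inPrism u a b g c) →
    mirror v α c ∈ R × T (inPrism u a b g (mirror v α c)) × isBlack (mirror v α c) ≡ not (isBlack c)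
  reverses {c} c∈R inP =
    let α∈ , inP′ = inPrism-mirror g c axis inP in closed c∈R inP , inP′ , isBlack-mirror v c α∈

UnitSquareIn-cube : ∀ {u s k R} → UnitSquareIn u s k R → ∃[ c ] c ∈ R × pcoord u c ≡ s
UnitSquareIn-cube {u} {s} {k} (inj₁ c∈R) = _ , c∈R , pcoord-embed u s k
UnitSquareIn-cube {u} {s} {k} (inj₂ c∈R) = _ , c∈R , pcoord-embed u s (k - + 1)

SquareIn-cube : ∀ {u a b k R p q} → SquareIn u a b k R → InPair a p → InPair b q →
  ∃[ c ] c ∈ R × pcoord u c ≡ (p , q)
SquareIn-cube (sq , _ , _ , _) (inj₁ refl) (inj₁ refl) = UnitSquareIn-cube sq
SquareIn-cube (_ , sq , _ , _) (inj₂ refl) (inj₁ refl) = UnitSquareIn-cube sq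
SquareIn-cube (_ , _ , sq , _) (inj₁ refl) (inj₂ refl) = UnitSquareIn-cube sq
SquareIn-cube (_ , _ , _ , sq) (inj₂ refl) (inj₂ refl) = UnitSquareIn-cube sq

SquareIn-block-cube : ∀ {u a b k R s} → SquareIn u a b k R → T (inBlock a b s) →
  ∃[ c ] c ∈ R × pcoord u c ≡ s
SquareIn-block-cube sq blk = let p∈ , q∈ = inBlock⁻ blk in SquareIn-cube sq p∈ q∈

SquareIn-axis-cube : ∀ {u a b k R v α x} → SquareIn u a b k R → InPlaneAxis u a b v α → InPair α x →
  ∃[ c ] c ∈ R × wcoord v c ≡ x
SquareIn-axis-cube {u} sq first x∈ with SquareIn-cube sq x∈ (inj₁ refl)
... | c , c∈R , eq = c , c∈R , cong proj₁ (trans (sym (pcoord-axes u c)) eq)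
SquareIn-axis-cube {u} sq second x∈ with SquareIn-cube sq (inj₁ refl) x∈
... | c , c∈R , eq = c , c∈R , cong proj₂ (trans (sym (pcoord-axes u c)) eq)

InRange : ℤ → ℕ → ℤ → Set
InRange k N x = ∃[ i ] i < N × x ≡ k + + i

module Pseudocylinder (w : Dir) (k : ℤ) (D : PlanarRegion) (N : ℕ) where

  R : Region
  R = pseudocylinder w k D N

  column : ℤ × ℤ → Region
  column s = map (λ t → embed w s (k + + t)) (upTo N)

  ∈⁻ : ∀ {c} → c ∈ R → pcoord w c ∈ D × InRange k N (wcoord w c)
  ∈⁻ c∈R with find (∈-concatMap⁻ column {xs = D} c∈R)
  ... | s , s∈D , c∈column with ∈-map⁻ (λ t → embed w s (k + + t)) c∈column
  ... | i , i∈ , refl = subst (_∈ D) (sym (pcoord-embed w s _)) s∈D , i , ∈-upTo⁻ i∈ , wcoord-embed w s _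

  ∈⁺ : ∀ {c} → pcoord w c ∈ D → InRange k N (wcoord w c) → c ∈ R
  ∈⁺ {c} s∈D (i , i<N , eq) =
    subst (_∈ R) (trans (cong (embed w (pcoord w c)) (sym eq)) (embed-coords w c))
      (∈-concatMap⁺ column (lose s∈D (∈-map⁺ (λ t → embed w (pcoord w c) (k + + t)) (∈-upTo⁺ i<N))))

  normal-mirror-closed : ∀ {a b k'} g → SquareIn w a b k' R →
    ∀ {c} → c ∈ R → T (inPrism w a b g c) → mirror (axis₁ w) a c ∈ R
  normal-mirror-closed {a} {b} g sq {c} c∈R inP = ∈⁺ base height
    where
    m = mirror (axis₁ w) a c
    base : pcoord w m ∈ D
    base with SquareIn-block-cube sq (inPrism⇒inBlock {w} {a} {b} g m (proj₂ (inPrism-mirror {w} {a} {b} g c first inP)))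
    ... | c′ , c′∈R , eq = subst (_∈ D) eq (proj₁ (∈⁻ c′∈R))
    height : InRange k N (wcoord w m)
    height = subst (InRange k N) (sym (wcoord-mirror-axis₁ w a c)) (proj₂ (∈⁻ c∈R))

  inPlane-mirror-closed : ∀ {u a b k' α} g → SquareIn u a b k' R → InPlaneAxis u a b w α →
    ∀ {c} → c ∈ R → T (inPrism u a b g c) → mirror w α c ∈ R
  inPlane-mirror-closed {α = α} g sq axis {c} c∈R inP = ∈⁺ base height
    where
    base : pcoord w (mirror w α c) ∈ D
    base = subst (_∈ D) (sym (pcoord-embed w _ _)) (proj₁ (∈⁻ c∈R))
    height : InRange k N (wcoord w (mirror w α c))
    height with SquareIn-axis-cube sq axis (reflect-InPair (proj₁ (inPrism-mirror g c axis inP)))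
    ... | c′ , c′∈R , eq = subst (InRange k N) (trans eq (sym (wcoord-embed w _ _))) (proj₂ (∈⁻ c′∈R))

  inPrism-balanced : ∀ {u a b k'} g → SquareIn u a b k' R →
    countᵇ (λ c → inPrism u a b g c ∧ isBlack c) R ≡ countᵇ (λ c → inPrism u a b g c ∧ isWhite c) R
  inPrism-balanced {u} {a} {b} g sq with normal-or-inPlane u w a b
  ... | inj₁ refl = inPrism-balanced-by-mirror R g first (normal-mirror-closed g sq)
  ... | inj₂ (α , axis) = inPrism-balanced-by-mirror R g axis (inPlane-mirror-closed g sq axis)

lemma4p5 : (w : Dir) (k : ℤ) (D : PlanarRegion) (N : ℕ) → NonZero N →
    ConnectedInterior D → FullyBalanced (pseudocylinder w k D N)
lemma4p5 w k D N _ _ u a b k' sq = balanced (k' ≤ᵇ_) , balanced (λ t → not (k' ≤ᵇ t))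
  where
  balanced = λ g → Pseudocylinder.inPrism-balanced w k D N g sq
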